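{- Let $q$ be a prime power and $k$ a positive integer, and let $M$ be a simple $GF(q)$-representable matroid with tree-width $k$. Then $M$ has a cocircuit with at most $q^{k-1}$ elements.
   Context: Matroid tree-width: a tree-decomposition of $M$ is a pair $(T,\tau)$ with $T$ a tree and $\tau:E(M)\to V(T)$ an arbitrary map. For a vertex $v$ of $T$, let $T_1,\dots,T_c$ be the components of $T-v$ and $B_j=\{e\in E(M):\tau(e)\in V(T_j)\}$. The rank defect of a set $B$ is $\mathrm{rd}(B)=r(M)-r(E(M)-B)$. The node width of $v$ is $r(M)-\sum_{j=1}^{c}\mathrm{rd}(B_j)$ (equal to $r(M)$ if $T$ has one vertex). The width of $(T,\tau)$ is the maximum node width over the vertices of $T$, and the tree-width of $M$ is the minimum width over all tree-decompositions of $M$. -}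

module Defs where

open import Data.Nat as ℕ using (ℕ; zero; suc; _≤_; _<_; _^_)
open import Data.Nat.Primality using (Prime)
open import Data.Integer as ℤ using (ℤ; +_; _-_; _⊔_)
open import Data.Fin using (Fin; zero; suc; toℕ; _≟_)
open import Data.Fin.Subset using (Subset; ∣_∣; ∁; _⊆_; _⊂_; _∈_; _∉_; ⊤; ⁅_⁆; _∪_)
open import Data.Vec using (tabulate)
open import Data.Bool using (Bool; true; false; _∨_; if_then_else_)
open import Data.Product using (Σ; _×_; ∃; ∃-syntax)
open import Algebra.Structures using (IsCommutativeRing)
open import Relation.Binary.PropositionalEquality using (_≡_; _≢_)
open import Relation.Nullary.Decidable using (⌊_⌋)

IsPrimePower : ℕ → Set
IsPrimePower q = Σ ℕ λ p → Σ ℕ λ e → Prime p × 1 ≤ e × q ≡ p ^ e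

-- A finite field with q elements, with carrier Fin q and equality _≡_.
-- (Any field of order q is GF(q).)

record FiniteField (q : ℕ) : Set where
  field
    _+_ _*_ : Fin q → Fin q → Fin q
    -_      : Fin q → Fin q
    0# 1#   : Fin q
    isCommutativeRing : IsCommutativeRing _≡_ _+_ _*_ -_ 0# 1#
    0≢1     : 0# ≢ 1#
    inverse : ∀ x → x ≢ 0# → Σ (Fin q) λ y → x * y ≡ 1#

module _ {q : ℕ} (F : FiniteField q) where
  open FiniteField F

  sumF : ∀ {n} → (Fin n → Fin q) → Fin q
  sumF {zero}  f = 0#
  sumF {suc n} f = f zero + sumF (λ i → f (suc i))

  LinIndep : ∀ {n d} → (Fin n → Fin d → Fin q) → Subset n → Set
  LinIndep {n} {d} v T =
    (c : Fin n → Fin q) → (∀ i → i ∉ T → c i ≡ 0#) →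
    (∀ j → sumF (λ i → c i * v i j) ≡ 0#) → ∀ i → c i ≡ 0#

  IsVecRank : ∀ {n d} → (Fin n → Fin d → Fin q) → Subset n → ℕ → Set
  IsVecRank v S r =
    (Σ _ λ T → T ⊆ S × LinIndep v T × ∣ T ∣ ≡ r) ×
    (∀ T → T ⊆ S → LinIndep v T → ∣ T ∣ ≤ r)

-- Matroids on ground set Fin n, given by their rank function.

RankFn : ℕ → Set
RankFn n = Subset n → ℕ

Representable : ∀ {q n} → FiniteField q → RankFn n → Set
Representable {q} {n} F r =
  Σ ℕ λ d → Σ (Fin n → Fin d → Fin q) λ v → ∀ S → IsVecRank F v S (r S)

Simple : ∀ {n} → RankFn n → Set
Simple {n} r =
  (∀ e → r ⁅ e ⁆ ≡ 1) × (∀ (e f : Fin n) → e ≢ f → r (⁅ e ⁆ ∪ ⁅ f ⁆) ≡ 2)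

-- C is a cocircuit: a circuit of the dual M*, i.e. a minimal set C
-- that is dependent in M*, i.e. with r(E - C) < r(M).
Cocircuit : ∀ {n} → RankFn n → Subset n → Set
Cocircuit r C = r (∁ C) < r ⊤ × (∀ D → D ⊂ C → r (∁ D) ≡ r ⊤)

-- A tree on vertex set Fin (suc m), rooted at zero, in which the
-- parent of vertex (suc i) is  parent i, of smaller index.  Every finite
-- tree is isomorphic to one of this form (number vertices in BFS order).

record Tree (m : ℕ) : Set where
  field
    parent    : Fin m → Fin (suc m)
    parent<   : ∀ i → toℕ (parent i) ≤ toℕ i

module _ {m : ℕ} (T : Tree m) where
  open Tree T

  up : Fin (suc m) → Fin (suc m)
  up zero    = zero
  up (suc i) = parent i

  iter : ℕ → Fin (suc m) → Fin (suc m)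
  iter zero    u = u
  iter (suc k) u = iter k (up u)

  anyUpTo : ℕ → (ℕ → Bool) → Bool
  anyUpTo zero    p = p zero
  anyUpTo (suc k) p = p (suc k) ∨ anyUpTo k p

  -- u lies in the subtree rooted at w (u is w or a descendant of w)
  inSub : Fin (suc m) → Fin (suc m) → Bool
  inSub w u = anyUpTo m λ k → ⌊ iter k u ≟ w ⌋

  isRoot : Fin (suc m) → Bool
  isRoot zero    = true
  isRoot (suc _) = false

  sumℤ : ∀ {k} → (Fin k → ℤ) → ℤ
  sumℤ {zero}  f = + 0
  sumℤ {suc k} f = f zero ℤ.+ sumℤ (λ i → f (suc i))

  maxℤ : ∀ {k} → (Fin (suc k) → ℤ) → ℤ
  maxℤ {zero}  f = f zero
  maxℤ {suc k} f = f zero ⊔ maxℤ (λ i → f (suc i))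

  module _ {n : ℕ} (r : RankFn n) (τ : Fin n → Fin (suc m)) where

    rd : Subset n → ℤ
    rd B = + r ⊤ - + r (∁ B)

    -- B for the component of T - v that is the subtree of child w
    Bsub : Fin (suc m) → Subset n
    Bsub w = tabulate λ e → inSub w (τ e)

    -- B for the component of T - v containing the parent of v (v ≠ root)
    Bup : Fin (suc m) → Subset n
    Bup v = tabulate λ e → if inSub v (τ e) then false else true

    -- components of T - v: the subtrees of the children of v, together
    -- with (when v is not the root) the rest of the tree.
    nodeWidth : Fin (suc m) → ℤ
    nodeWidth v =
      + r ⊤ - (sumℤ (λ i → if ⌊ parent i ≟ v ⌋ then rd (Bsub (suc i)) else + 0)
               ℤ.+ (if isRoot v then + 0 else rd (Bup v)))

    width : ℤ
    width = maxℤ nodeWidth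

TreeWidth : ∀ {n} → RankFn n → ℕ → Set
TreeWidth {n} r k =
  (Σ ℕ λ m → Σ (Tree m) λ T → Σ (Fin n → Fin (suc m)) λ τ → width T r τ ≡ + k) ×
  (∀ m (T : Tree m) (τ : Fin n → Fin (suc m)) → + k ℤ.≤ width T r τ)

-- Walking down a tree-decomposition of width k from the root, always into a subtree
-- whose complement is not spanning, one stops at a node whose subtree (or, at the
-- root, the whole ground set) is a set X with r(E - X) < r(M) and r(X) <= k.
-- Extend a basis of E - X to a basis B of M and pick j0 in B outside it: the elements
-- with nonzero j0-coordinate form the complement of the hyperplane spanned by B - j0,
-- a cocircuit C inside X.  Rescaled to j0-coordinate 1, the elements of C are pairwise
-- non-parallel (M is simple) points of an affine hyperplane of the span of X, which has
-- q ^ (r(X) - 1) points.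

module Submission where

open import Defs
open import Level using (0ℓ)
open import Algebra.Bundles using (CommutativeRing)
import Algebra.Properties.Ring as RingProperties
import Algebra.Properties.Semiring.Sum as SemiringSum
open import Data.Nat as ℕ using (ℕ; zero; suc; _≤_; _<_; _^_; _∸_; s≤s)
import Data.Nat.Properties as ℕ
open import Data.Fin as Fin using (Fin; zero; suc; toℕ; funToFin; finToFun)
open import Data.Fin.Properties as Fin
  using (suc-injective; toℕ-injective; toℕ<n; injective⇒≤; all?; any?; ¬∀⟶∃¬;
         finToFun-funToFin; funToFin-finToFin; punchInᵢ≢i; nonZeroIndex)
open import Data.Fin.Subset hiding (_-_)
open import Data.Fin.Subset.Properties
open import Data.Vec using ([]; _∷_; here; there; tabulate)
open import Data.Vec.Properties using (lookup∘tabulate; []=⇒lookup; lookup⇒[]=; tabulate-∘; tabulate-cong)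
open import Data.Bool using (true; false; not; if_then_else_)
open import Data.Integer.Tactic.RingSolver using (solve-∀)
open import Data.Product using (Σ; ∃; _×_; _,_; proj₁; proj₂)
open import Data.Sum using (_⊎_; inj₁; inj₂; [_,_]′)
open import Data.Empty using (⊥-elim)
open import Function using (_∘_; id)
open import Data.List using (List; []; _∷_; allFin)
open import Data.List.Relation.Unary.Any using (here; there)
import Data.List.Membership.Propositional as List
open import Data.List.Membership.Propositional.Properties using (∈-allFin)
open import Relation.Binary.PropositionalEquality
open import Relation.Nullary using (Dec; yes; no; ¬_)
open import Relation.Nullary.Decidable using (⌊_⌋; decidable-stable; toSum; _→-dec_; _×-dec_; ¬?)

module FieldProperties {q : ℕ} (F : FiniteField q) where

  commutativeRing : CommutativeRing 0ℓ 0ℓ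
  commutativeRing = record { isCommutativeRing = FiniteField.isCommutativeRing F }

  open CommutativeRing commutativeRing public
    using (_+_; _*_; -_; _-_; 0#; 1#; ring; semiring; +-identityʳ; -‿inverseʳ;
           *-assoc; *-comm; *-identityˡ; *-identityʳ; zeroˡ; zeroʳ)
  open RingProperties ring public
    using (-0#≈0#; -1*x≈-x; x∙y⁻¹≈ε⇒x≈y; [y-z]x≈yx-zx)
  open SemiringSum semiring public
    using (sum; sum-cong-≗; ∑-distrib-+; ∑-comm; *-distribˡ-sum; *-distribʳ-sum; sum-replicate-zero; sum-remove)
  open FiniteField F public using (0≢1; inverse)
  open ≡-Reasoning

  1<q : 1 < q
  1<q = ℕ.≰⇒> λ q≤1 → 0≢1 (toℕ-injective (trans (toℕ≡0 q≤1 0#) (sym (toℕ≡0 q≤1 1#))))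
    where
    toℕ≡0 : q ≤ 1 → (x : Fin q) → toℕ x ≡ 0
    toℕ≡0 q≤1 x = ℕ.n<1⇒n≡0 (ℕ.<-≤-trans (toℕ<n x) q≤1)

  x*y≡0⇒y≡0 : ∀ {x y} → x ≢ 0# → x * y ≡ 0# → y ≡ 0#
  x*y≡0⇒y≡0 {x} {y} x≢0 xy≡0 = let x' , xx'≡1 = inverse x x≢0 in begin
    y              ≡⟨ *-identityˡ y ⟨
    1# * y         ≡⟨ cong (_* y) (trans (sym xx'≡1) (*-comm x x')) ⟩
    (x' * x) * y   ≡⟨ *-assoc x' x y ⟩
    x' * (x * y)   ≡⟨ cong (x' *_) xy≡0 ⟩
    x' * 0#        ≡⟨ zeroʳ x' ⟩
    0#             ∎

  *-cancelʳ : ∀ {x y z} → z ≢ 0# → x * z ≡ y * z → x ≡ y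
  *-cancelʳ {x} {y} {z} z≢0 eq = x∙y⁻¹≈ε⇒x≈y x y (x*y≡0⇒y≡0 z≢0 (begin
    z * (x - y)     ≡⟨ *-comm z (x - y) ⟩
    (x - y) * z     ≡⟨ [y-z]x≈yx-zx z x y ⟩
    x * z - y * z   ≡⟨ cong (_- y * z) eq ⟩
    y * z - y * z   ≡⟨ -‿inverseʳ (y * z) ⟩
    0#              ∎))

  x≡0⇒x*y≡x*z : ∀ {x} y z → x ≡ 0# → x * y ≡ x * z
  x≡0⇒x*y≡x*z y z refl = trans (zeroˡ y) (sym (zeroˡ z))

  -- A total inverse; the value at 0# is junk.
  _⁻¹ : Fin q → Fin q
  x ⁻¹ with x Fin.≟ 0#
  ... | yes _   = 0#
  ... | no x≢0 = proj₁ (inverse x x≢0)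

  x*x⁻¹≡1 : ∀ {x} → x ≢ 0# → x * x ⁻¹ ≡ 1#
  x*x⁻¹≡1 {x} x≢0 with x Fin.≟ 0#
  ... | yes x≡0 = ⊥-elim (x≢0 x≡0)
  ... | no x≢0' = proj₂ (inverse x x≢0')

  x⁻¹≢0 : ∀ {x} → x ≢ 0# → x ⁻¹ ≢ 0#
  x⁻¹≢0 {x} x≢0 x⁻¹≡0 = 0≢1 (begin
    0#           ≡⟨ zeroʳ x ⟨
    x * 0#       ≡⟨ cong (x *_) x⁻¹≡0 ⟨
    x * x ⁻¹     ≡⟨ x*x⁻¹≡1 x≢0 ⟩
    1#           ∎)

  sumF≡sum : ∀ {n} (f : Fin n → Fin q) → sumF F f ≡ sum f
  sumF≡sum {zero}  f = refl
  sumF≡sum {suc n} f = cong (f zero +_) (sumF≡sum (f ∘ suc))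

  sum-zero : ∀ {n} {f : Fin n → Fin q} → (∀ i → f i ≡ 0#) → sum f ≡ 0#
  sum-zero {n} f≡0 = trans (sum-cong-≗ f≡0) (sum-replicate-zero n)

  sum-[f-g] : ∀ {n} (f g : Fin n → Fin q) → sum (λ i → f i - g i) ≡ sum f - sum g
  sum-[f-g] f g = begin
    sum (λ i → f i - g i)          ≡⟨ ∑-distrib-+ f (λ i → - g i) ⟩
    sum f + sum (λ i → - g i)      ≡⟨ cong (sum f +_) (sum-cong-≗ λ i → sym (-1*x≈-x (g i))) ⟩
    sum f + sum (λ i → - 1# * g i) ≡⟨ cong (sum f +_) (*-distribˡ-sum (- 1#) g) ⟨
    sum f + - 1# * sum g           ≡⟨ cong (sum f +_) (-1*x≈-x (sum g)) ⟩
    sum f - sum g                  ∎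

  sum-single : ∀ {n} (f : Fin n → Fin q) k → (∀ i → i ≢ k → f i ≡ 0#) → sum f ≡ f k
  sum-single {suc n} f k f≡0 = begin
    sum f                         ≡⟨ sum-remove {i = k} f ⟩
    f k + sum (f ∘ Fin.punchIn k) ≡⟨ cong (f k +_) (sum-zero (λ j → f≡0 _ (punchInᵢ≢i k j))) ⟩
    f k + 0#                      ≡⟨ +-identityʳ (f k) ⟩
    f k                           ∎

  sum≢0⇒∃≢0 : ∀ {n} (f : Fin n → Fin q) → sum f ≢ 0# → ∃ λ i → f i ≢ 0#
  sum≢0⇒∃≢0 {n} f sum≢0 = ¬∀⟶∃¬ n _ (λ i → f i Fin.≟ 0#) (sum≢0 ∘ sum-zero)

enumerate : ∀ {n} (p : Subset n) → Fin ∣ p ∣ → Fin n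
enumerate (inside ∷ p)  zero    = zero
enumerate (inside ∷ p)  (suc k) = suc (enumerate p k)
enumerate (outside ∷ p) k       = suc (enumerate p k)

enumerate-∈ : ∀ {n} (p : Subset n) k → enumerate p k ∈ p
enumerate-∈ (inside ∷ p)  zero    = here
enumerate-∈ (inside ∷ p)  (suc k) = there (enumerate-∈ p k)
enumerate-∈ (outside ∷ p) k       = there (enumerate-∈ p k)

enumerate-injective : ∀ {n} (p : Subset n) {k l} → enumerate p k ≡ enumerate p l → k ≡ l
enumerate-injective (inside ∷ p)  {zero}  {zero}  _  = refl
enumerate-injective (inside ∷ p)  {suc k} {suc l} eq = cong suc (enumerate-injective p (suc-injective eq))
enumerate-injective (outside ∷ p)                 eq = enumerate-injective p (suc-injective eq)

enumerate-surjective : ∀ {n} (p : Subset n) {i} → i ∈ p → ∃ λ k → enumerate p k ≡ i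
enumerate-surjective (inside ∷ p)  here       = zero , refl
enumerate-surjective (inside ∷ p)  (there i∈p) = let k , eq = enumerate-surjective p i∈p in suc k , cong suc eq
enumerate-surjective (outside ∷ p) (there i∈p) = let k , eq = enumerate-surjective p i∈p in k , cong suc eq

⁅⁆⊆ : ∀ {n} {p : Subset n} {x} → x ∈ p → ⁅ x ⁆ ⊆ p
⁅⁆⊆ {p = p} {x} x∈p i∈⁅x⁆ = subst (_∈ p) (sym (x∈⁅y⁆⇒x≡y x i∈⁅x⁆)) x∈p

module _ {n : ℕ} {p : Subset n} {x : Fin n} where

  ∪⁅⁆⊆ : ∀ {q} → p ⊆ q → x ∈ q → p ∪ ⁅ x ⁆ ⊆ q
  ∪⁅⁆⊆ p⊆q x∈q i∈ = [ p⊆q , ⁅⁆⊆ x∈q ]′ (x∈p∪q⁻ p ⁅ x ⁆ i∈)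

  ∉∪⁅⁆ : ∀ {i} → i ∉ p → i ≢ x → i ∉ p ∪ ⁅ x ⁆
  ∉∪⁅⁆ i∉p i≢x i∈ = [ i∉p , i≢x ∘ x∈⁅y⁆⇒x≡y x ]′ (x∈p∪q⁻ p ⁅ x ⁆ i∈)

  ∉⇒⊂∪⁅⁆ : x ∉ p → p ⊂ p ∪ ⁅ x ⁆
  ∉⇒⊂∪⁅⁆ x∉p = p⊆p∪q ⁅ x ⁆ , x , x∈p∪q⁺ (inj₂ (x∈⁅x⁆ x)) , x∉p

x∉p-x : ∀ {n} {p : Subset n} x → x ∉ p ─ ⁅ x ⁆
x∉p-x {p = s ∷ p} zero    ()
x∉p-x {p = s ∷ p} (suc x) (there x∈) = x∉p-x x x∈

x∈p⇒∣p∣≡1+∣p-x∣ : ∀ {n} {p : Subset n} {x} → x ∈ p → ∣ p ∣ ≡ suc ∣ p ─ ⁅ x ⁆ ∣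
x∈p⇒∣p∣≡1+∣p-x∣ {p = inside ∷ p}  {zero}  here        = cong (suc ∘ ∣_∣) (sym (p─⊥≡p p))
x∈p⇒∣p∣≡1+∣p-x∣ {p = inside ∷ p}  {suc x} (there x∈p) = cong suc (x∈p⇒∣p∣≡1+∣p-x∣ x∈p)
x∈p⇒∣p∣≡1+∣p-x∣ {p = outside ∷ p} {suc x} (there x∈p) = x∈p⇒∣p∣≡1+∣p-x∣ x∈p

module _ {A : Set} (z : A) where

  extend : ∀ {n} (p : Subset n) → (Fin ∣ p ∣ → A) → Fin n → A
  extend (inside ∷ p)  c zero    = c zero
  extend (inside ∷ p)  c (suc i) = extend p (c ∘ suc) i
  extend (outside ∷ p) c zero    = z
  extend (outside ∷ p) c (suc i) = extend p c i

  extend-enumerate : ∀ {n} (p : Subset n) c k → extend p c (enumerate p k) ≡ c k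
  extend-enumerate (inside ∷ p)  c zero    = refl
  extend-enumerate (inside ∷ p)  c (suc k) = extend-enumerate p (c ∘ suc) k
  extend-enumerate (outside ∷ p) c k       = extend-enumerate p c k

  extend-∉ : ∀ {n} (p : Subset n) c {i} → i ∉ p → extend p c i ≡ z
  extend-∉ (inside ∷ p)  c {zero}  i∉p = ⊥-elim (i∉p here)
  extend-∉ (inside ∷ p)  c {suc i} i∉p = extend-∉ p (c ∘ suc) (i∉p ∘ there)
  extend-∉ (outside ∷ p) c {zero}  i∉p = refl
  extend-∉ (outside ∷ p) c {suc i} i∉p = extend-∉ p c (i∉p ∘ there)

funToFin-cong : ∀ {a b} {f g : Fin a → Fin b} → f ≗ g → funToFin f ≡ funToFin g
funToFin-cong {zero}  f≗g = refl
funToFin-cong {suc a} f≗g = cong₂ Fin.combine (f≗g zero) (funToFin-cong (f≗g ∘ suc))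

finToFun-injective : ∀ {a b} {x y : Fin (b ^ a)} → finToFun {b} {a} x ≗ finToFun y → x ≡ y
finToFun-injective {a} {b} {x} {y} eq =
  trans (sym (funToFin-finToFin {a} {b} x)) (trans (funToFin-cong eq) (funToFin-finToFin {a} {b} y))

≤-^-if-injective : ∀ {a b q} (f : Fin a → Fin b → Fin q) → (∀ {x y} → f x ≗ f y → x ≡ y) → a ≤ q ^ b
≤-^-if-injective {a} {b} {q} f f-inj = injective⇒≤ λ {x} {y} eq → f-inj λ i → begin
  f x i                       ≡⟨ finToFun-funToFin (f x) i ⟨
  finToFun (funToFin (f x)) i ≡⟨ cong (λ (c : Fin (q ^ b)) → finToFun c i) eq ⟩
  finToFun (funToFin (f y)) i ≡⟨ finToFun-funToFin (f y) i ⟩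
  f y i                       ∎
  where open ≡-Reasoning

module LinearAlgebra {q : ℕ} (F : FiniteField q) {n d : ℕ} (v : Fin n → Fin d → Fin q) where
  open FieldProperties F
  open ≡-Reasoning

  Comb : (Fin n → Fin q) → Fin d → Fin q
  Comb c j = sum λ i → c i * v i j

  SupportedOn : Subset n → (Fin n → Fin q) → Set
  SupportedOn T c = ∀ i → i ∉ T → c i ≡ 0#

  Independent : Subset n → Set
  Independent T = ∀ c → SupportedOn T c → (∀ j → Comb c j ≡ 0#) → ∀ i → c i ≡ 0#

  _∈Span_ : (Fin d → Fin q) → Subset n → Set
  w ∈Span T = Σ (Fin n → Fin q) λ c → SupportedOn T c × (∀ j → Comb c j ≡ w j)

  LinIndep⇒Independent : ∀ {T} → LinIndep F v T → Independent T
  LinIndep⇒Independent li c c-supp rel = li c c-supp λ j → trans (sumF≡sum (λ i → c i * v i j)) (rel j)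

  Independent⇒LinIndep : ∀ {T} → Independent T → LinIndep F v T
  Independent⇒LinIndep ind c c-supp rel = ind c c-supp λ j → trans (sym (sumF≡sum (λ i → c i * v i j))) (rel j)

  δ : Fin n → Fin n → Fin q
  δ e i with i Fin.≟ e
  ... | yes _ = 1#
  ... | no  _ = 0#

  δ-same : ∀ e → δ e e ≡ 1#
  δ-same e with e Fin.≟ e
  ... | yes _   = refl
  ... | no  e≢e = ⊥-elim (e≢e refl)

  δ-other : ∀ {e i} → i ≢ e → δ e i ≡ 0#
  δ-other {e} {i} i≢e with i Fin.≟ e
  ... | yes i≡e = ⊥-elim (i≢e i≡e)
  ... | no  _   = refl

  δ-supported : ∀ {T e} → e ∈ T → SupportedOn T (δ e)
  δ-supported {e = e} e∈T i i∉T = δ-other {e} {i} λ { refl → i∉T e∈T }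

  Comb-cong : ∀ {c c'} → (∀ i → c i ≡ c' i) → ∀ j → Comb c j ≡ Comb c' j
  Comb-cong c≗c' j = sum-cong-≗ λ i → cong (_* v i j) (c≗c' i)

  Comb-* : ∀ x c j → Comb (λ i → x * c i) j ≡ x * Comb c j
  Comb-* x c j = trans (sum-cong-≗ λ i → *-assoc x (c i) (v i j)) (sym (*-distribˡ-sum x (λ i → c i * v i j)))

  Comb-[c-c'] : ∀ c c' j → Comb (λ i → c i - c' i) j ≡ Comb c j - Comb c' j
  Comb-[c-c'] c c' j = trans (sum-cong-≗ λ i → [y-z]x≈yx-zx (v i j) (c i) (c' i))
                        (sum-[f-g] (λ i → c i * v i j) (λ i → c' i * v i j))

  Comb-δ : ∀ e j → Comb (δ e) j ≡ v e j
  Comb-δ e j = begin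
    Comb (δ e) j     ≡⟨ sum-single _ e (λ i i≢e → trans (cong (_* v i j) (δ-other i≢e)) (zeroˡ (v i j))) ⟩
    δ e e * v e j    ≡⟨ cong (_* v e j) (δ-same e) ⟩
    1# * v e j       ≡⟨ *-identityˡ (v e j) ⟩
    v e j            ∎

  coefficients-unique : ∀ {T} → Independent T → ∀ {c c'} → SupportedOn T c → SupportedOn T c' →
                        (∀ j → Comb c j ≡ Comb c' j) → ∀ i → c i ≡ c' i
  coefficients-unique ind {c} {c'} c-supp c'-supp Comb≡ i =
    x∙y⁻¹≈ε⇒x≈y (c i) (c' i) (ind (λ i → c i - c' i) diff-supp diff-rel i)
    where
    diff-supp : SupportedOn _ (λ i → c i - c' i)
    diff-supp i i∉T = trans (cong₂ _-_ (c-supp i i∉T) (c'-supp i i∉T)) (-‿inverseʳ 0#)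
    diff-rel : ∀ j → Comb (λ i → c i - c' i) j ≡ 0#
    diff-rel j = trans (Comb-[c-c'] c c' j) (trans (cong (_- Comb c' j) (Comb≡ j)) (-‿inverseʳ _))

  support : (Fin n → Fin q) → Subset n
  support φ = tabulate λ e → not ⌊ φ e Fin.≟ 0# ⌋

  ∈-support⁻ : ∀ {φ e} → e ∈ support φ → φ e ≢ 0#
  ∈-support⁻ {φ} {e} e∈ φe≡0 with trans (sym (lookup∘tabulate _ e)) ([]=⇒lookup e∈)
  ... | not⌊φe≟0⌋≡true with φ e Fin.≟ 0#
  ...   | no φe≢0 = φe≢0 φe≡0

  ∈-support⁺ : ∀ {φ e} → φ e ≢ 0# → e ∈ support φ
  ∈-support⁺ {φ} {e} φe≢0 = lookup⇒[]= e (support φ) (trans (lookup∘tabulate _ e) not⌊φe≟0⌋≡true)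
    where
    not⌊φe≟0⌋≡true : not ⌊ φ e Fin.≟ 0# ⌋ ≡ true
    not⌊φe≟0⌋≡true with φ e Fin.≟ 0#
    ... | yes φe≡0 = ⊥-elim (φe≢0 φe≡0)
    ... | no  _    = refl

  ∉-support : ∀ {φ e} → e ∉ support φ → φ e ≡ 0#
  ∉-support {φ} {e} e∉ = decidable-stable (φ e Fin.≟ 0#) (e∉ ∘ ∈-support⁺)

  supported-∪⁅⁆ : ∀ {G e c} → SupportedOn (G ∪ ⁅ e ⁆) c → c e ≡ 0# → SupportedOn G c
  supported-∪⁅⁆ {G} {e} {c} c-supp ce≡0 i i∉G =
    [ (λ { refl → ce≡0 }) , (λ i≢e → c-supp i (∉∪⁅⁆ i∉G i≢e)) ]′ (toSum (i Fin.≟ e))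

  independent-mono : ∀ {S T} → S ⊆ T → Independent T → Independent S
  independent-mono S⊆T ind c c-supp = ind c λ i i∉T → c-supp i (i∉T ∘ S⊆T)

  span-mono : ∀ {S T w} → S ⊆ T → w ∈Span S → w ∈Span T
  span-mono S⊆T (c , c-supp , Comb≡) = c , (λ i i∉T → c-supp i (i∉T ∘ S⊆T)) , Comb≡

  ∈⇒∈Span : ∀ {T e} → e ∈ T → v e ∈Span T
  ∈⇒∈Span e∈T = δ _ , δ-supported e∈T , Comb-δ _

  Relation : Subset n → (Fin n → Fin q) → Set
  Relation T c = SupportedOn T c × (∀ j → Comb c j ≡ 0#)

  relation? : ∀ T c → Dec (Relation T c)
  relation? T c = all? (λ i → ¬? (i ∈? T) →-dec (c i Fin.≟ 0#)) ×-dec all? (λ j → Comb c j Fin.≟ 0#)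

  relations-trivial? : ∀ T c → Dec (Relation T c → ∀ i → c i ≡ 0#)
  relations-trivial? T c = relation? T c →-dec all? (λ i → c i Fin.≟ 0#)

  -- Independence is decided by running through all q ^ n coefficient vectors.
  independent-or-dependent : ∀ T → Independent T ⊎ Σ (Fin n → Fin q) λ c → Relation T c × ¬ (∀ i → c i ≡ 0#)
  independent-or-dependent T with all? (relations-trivial? T ∘ finToFun)
  ... | yes all-trivial = inj₁ λ c c-supp rel i →
    let c≗ = finToFun-funToFin c in
    trans (sym (c≗ i)) (all-trivial (funToFin c)
      ((λ i i∉T → trans (c≗ i) (c-supp i i∉T)) , λ j → trans (Comb-cong c≗ j) (rel j)) i)
  ... | no ¬all-trivial =
    let x , nontrivial = ¬∀⟶∃¬ _ _ (relations-trivial? T ∘ finToFun) ¬all-trivial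
    in inj₂ ( finToFun x
            , decidable-stable (relation? T (finToFun x)) (λ ¬rel → nontrivial (⊥-elim ∘ ¬rel))
            , λ zero → nontrivial λ _ → zero )

  substitute : (Fin n → Fin n → Fin q) → (Fin n → Fin q) → Fin n → Fin q
  substitute a c i = sum λ t → c t * a t i

  substitute-supported : ∀ {I a} c → (∀ t → SupportedOn I (a t)) → SupportedOn I (substitute a c)
  substitute-supported {a = a} c a-supp i i∉I = sum-zero λ t → trans (cong (c t *_) (a-supp t i i∉I)) (zeroʳ (c t))

  Comb-substitute : ∀ a c → (∀ t j → c t * Comb (a t) j ≡ c t * v t j) → ∀ j → Comb (substitute a c) j ≡ Comb c j
  Comb-substitute a c rows j = begin
    sum (λ i → sum (λ t → c t * a t i) * v i j)  ≡⟨ sum-cong-≗ (λ i → *-distribʳ-sum (v i j) (λ t → c t * a t i)) ⟩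
    sum (λ i → sum (λ t → c t * a t i * v i j))  ≡⟨ ∑-comm (λ i t → c t * a t i * v i j) ⟩
    sum (λ t → sum (λ i → c t * a t i * v i j))  ≡⟨ sum-cong-≗ (λ t → sum-cong-≗ λ i → *-assoc (c t) (a t i) (v i j)) ⟩
    sum (λ t → sum (λ i → c t * (a t i * v i j))) ≡⟨ sum-cong-≗ (λ t → *-distribˡ-sum (c t) (λ i → a t i * v i j)) ⟨
    sum (λ t → c t * Comb (a t) j)               ≡⟨ sum-cong-≗ (λ t → rows t j) ⟩
    Comb c j                                     ∎

  module Rows {T I : Subset n} (T⊆Span : ∀ t → t ∈ T → v t ∈Span I) where

    row : ∀ t → Σ (Fin n → Fin q) λ a → SupportedOn I a × (t ∈ T → ∀ j → Comb a j ≡ v t j)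
    row t with t ∈? T
    ... | yes t∈T = let a , a-supp , Comb≡ = T⊆Span t t∈T in a , a-supp , λ _ → Comb≡
    ... | no  t∉T = (λ _ → 0#) , (λ _ _ → refl) , λ t∈T → ⊥-elim (t∉T t∈T)

    rows : Fin n → Fin n → Fin q
    rows t = proj₁ (row t)

    rows-supported : ∀ t → SupportedOn I (rows t)
    rows-supported t = proj₁ (proj₂ (row t))

    rows-spans : ∀ {t} → t ∈ T → ∀ j → Comb (rows t) j ≡ v t j
    rows-spans {t} = proj₂ (proj₂ (row t))

    rows-Comb : ∀ {c} → SupportedOn T c → ∀ t j → c t * Comb (rows t) j ≡ c t * v t j
    rows-Comb {c} c-supp t j = [ (λ t∈T → cong (c t *_) (rows-spans t∈T j))
                               , (λ t∉T → x≡0⇒x*y≡x*z _ _ (c-supp t t∉T)) ]′ (toSum (t ∈? T))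

  span-trans : ∀ {T I w} → (∀ t → t ∈ T → v t ∈Span I) → w ∈Span T → w ∈Span I
  span-trans T⊆Span (c , c-supp , Comb≡) =
    substitute rows c , substitute-supported c rows-supported ,
    λ j → trans (Comb-substitute rows c (rows-Comb c-supp) j) (Comb≡ j)
    where open Rows T⊆Span

  dependent-extension⇒∈Span : ∀ {G e c} → Independent G → Relation (G ∪ ⁅ e ⁆) c → ¬ (∀ i → c i ≡ 0#) →
                              v e ∈Span G
  dependent-extension⇒∈Span {G} {e} {c} ind (c-supp , rel) nontrivial =
    [ (λ ce≡0 → ⊥-elim (nontrivial (ind c (supported-∪⁅⁆ c-supp ce≡0) rel))) , solve-for-e ]′ (toSum (c e Fin.≟ 0#))
    where
    solve-for-e : c e ≢ 0# → v e ∈Span G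
    solve-for-e ce≢0 = c' , supported-∪⁅⁆ c'-supp c'e≡0 , Comb-c'
      where
      y : Fin q
      y = (c e) ⁻¹
      c' : Fin n → Fin q
      c' i = δ e i - y * c i
      c'-supp : SupportedOn (G ∪ ⁅ e ⁆) c'
      c'-supp i i∉ = begin
        δ e i - y * c i  ≡⟨ cong₂ _-_ (δ-supported (x∈p∪q⁺ (inj₂ (x∈⁅x⁆ e))) i i∉) (cong (y *_) (c-supp i i∉)) ⟩
        0# - y * 0#      ≡⟨ cong (λ x → 0# - x) (zeroʳ y) ⟩
        0# - 0#          ≡⟨ -‿inverseʳ 0# ⟩
        0#               ∎
      c'e≡0 : c' e ≡ 0#
      c'e≡0 = begin
        δ e e - y * c e  ≡⟨ cong₂ _-_ (δ-same e) (trans (*-comm y (c e)) (x*x⁻¹≡1 ce≢0)) ⟩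
        1# - 1#          ≡⟨ -‿inverseʳ 1# ⟩
        0#               ∎
      Comb-c' : ∀ j → Comb c' j ≡ v e j
      Comb-c' j = begin
        Comb c' j                              ≡⟨ Comb-[c-c'] (δ e) (λ i → y * c i) j ⟩
        Comb (δ e) j - Comb (λ i → y * c i) j  ≡⟨ cong₂ _-_ (Comb-δ e j) (trans (Comb-* y c j) (cong (y *_) (rel j))) ⟩
        v e j - y * 0#                         ≡⟨ cong (λ x → v e j + - x) (zeroʳ y) ⟩
        v e j - 0#                             ≡⟨ cong (v e j +_) -0#≈0# ⟩
        v e j + 0#                             ≡⟨ +-identityʳ (v e j) ⟩
        v e j                                  ∎

  independent-∪⁅⁆ : ∀ {G e} → Independent G → ¬ (v e ∈Span G) → Independent (G ∪ ⁅ e ⁆)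
  independent-∪⁅⁆ {G} {e} ind e∉SpanG with independent-or-dependent (G ∪ ⁅ e ⁆)
  ... | inj₁ ind' = ind'
  ... | inj₂ (c , rel , nontrivial) = ⊥-elim (e∉SpanG (dependent-extension⇒∈Span ind rel nontrivial))

  extend-to-spanning : ∀ {G} → Independent G → (es : List (Fin n)) →
    Σ (Subset n) λ B → Independent B × G ⊆ B × (∀ e → e List.∈ es → v e ∈Span B)
  extend-to-spanning ind [] = _ , ind , id , λ _ ()
  extend-to-spanning {G} ind (e ∷ es) with independent-or-dependent (G ∪ ⁅ e ⁆)
  ... | inj₁ ind' = let B , indB , G∪e⊆B , spans = extend-to-spanning ind' es in
    B , indB , G∪e⊆B ∘ p⊆p∪q ⁅ e ⁆ ,
    λ { _ (here refl) → span-mono G∪e⊆B (∈⇒∈Span (x∈p∪q⁺ (inj₂ (x∈⁅x⁆ e)))) ; e' (there e'∈es) → spans e' e'∈es }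
  ... | inj₂ (c , rel , nontrivial) = let B , indB , G⊆B , spans = extend-to-spanning ind es in
    B , indB , G⊆B ,
    λ { _ (here refl) → span-mono G⊆B (dependent-extension⇒∈Span ind rel nontrivial) ; e' (there e'∈es) → spans e' e'∈es }

  -- Steinitz exchange, by counting: substitution maps the q ^ ∣ T ∣ combinations
  -- of T injectively to combinations of I.
  steinitz : ∀ {T I} → Independent T → (∀ t → t ∈ T → v t ∈Span I) → ∣ T ∣ ≤ ∣ I ∣
  steinitz {T} {I} ind T⊆Span = ℕ.≮⇒≥ λ ∣I∣<∣T∣ → ℕ.<⇒≱ (ℕ.^-monoʳ-< q 1<q ∣I∣<∣T∣) q^∣T∣≤q^∣I∣
    where
    open Rows T⊆Span
    coefficients : Fin (q ^ ∣ T ∣) → Fin n → Fin q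
    coefficients x = extend 0# T (finToFun x)
    coefficients-supported : ∀ x → SupportedOn T (coefficients x)
    coefficients-supported x i i∉T = extend-∉ 0# T (finToFun x) i∉T
    image : Fin (q ^ ∣ T ∣) → Fin ∣ I ∣ → Fin q
    image x = substitute rows (coefficients x) ∘ enumerate I
    image-injective : ∀ {x y} → image x ≗ image y → x ≡ y
    image-injective {x} {y} image≗ = finToFun-injective λ k →
      trans (sym (extend-enumerate 0# T _ k)) (trans (same-coefficients (enumerate T k)) (extend-enumerate 0# T _ k))
      where
      same-substitute : ∀ i → substitute rows (coefficients x) i ≡ substitute rows (coefficients y) i
      same-substitute i with i ∈? I
      ... | yes i∈I = let k , eq = enumerate-surjective I i∈I in
                      subst (λ i → substitute rows _ i ≡ substitute rows _ i) eq (image≗ k)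
      ... | no  i∉I = trans (substitute-supported _ rows-supported i i∉I)
                            (sym (substitute-supported _ rows-supported i i∉I))
      same-coefficients : ∀ i → coefficients x i ≡ coefficients y i
      same-coefficients = coefficients-unique ind (coefficients-supported x) (coefficients-supported y) λ j → begin
        Comb (coefficients x) j                   ≡⟨ Comb-substitute rows _ (rows-Comb (coefficients-supported x)) j ⟨
        Comb (substitute rows (coefficients x)) j ≡⟨ Comb-cong same-substitute j ⟩
        Comb (substitute rows (coefficients y)) j ≡⟨ Comb-substitute rows _ (rows-Comb (coefficients-supported y)) j ⟩
        Comb (coefficients y) j                   ∎
    q^∣T∣≤q^∣I∣ : q ^ ∣ T ∣ ≤ q ^ ∣ I ∣
    q^∣T∣≤q^∣I∣ = ≤-^-if-injective image image-injective

-- X is dependent in the dual matroid, i.e. contains a cocircuit.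
Codependent : ∀ {n} → RankFn n → Subset n → Set
Codependent r X = r (∁ X) < r ⊤

module RepresentedMatroid {q : ℕ} (F : FiniteField q) {n d : ℕ} (v : Fin n → Fin d → Fin q)
                          (r : RankFn n) (rep : ∀ S → IsVecRank F v S (r S)) where
  open FieldProperties F
  open LinearAlgebra F v

  IsBasis : Subset n → Subset n → Set
  IsBasis I S = I ⊆ S × Independent I × ∣ I ∣ ≡ r S

  basis : ∀ S → Σ (Subset n) λ I → IsBasis I S
  basis S = let I , I⊆S , li , ∣I∣≡rS = proj₁ (rep S) in I , I⊆S , LinIndep⇒Independent li , ∣I∣≡rS

  independent⇒∣∣≤r : ∀ {I S} → I ⊆ S → Independent I → ∣ I ∣ ≤ r S
  independent⇒∣∣≤r {I} {S} I⊆S ind = proj₂ (rep S) I I⊆S (Independent⇒LinIndep ind)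

  r-mono : ∀ {S S'} → S ⊆ S' → r S ≤ r S'
  r-mono {S} S⊆S' = let I , I⊆S , ind , ∣I∣≡rS = basis S in
    subst (_≤ _) ∣I∣≡rS (independent⇒∣∣≤r (S⊆S' ∘ I⊆S) ind)

  r≤∣∣ : ∀ S → r S ≤ ∣ S ∣
  r≤∣∣ S = let I , I⊆S , _ , ∣I∣≡rS = basis S in subst (_≤ ∣ S ∣) ∣I∣≡rS (p⊆q⇒∣p∣≤∣q∣ I⊆S)

  basis-spans : ∀ {I S} → IsBasis I S → ∀ {e} → e ∈ S → v e ∈Span I
  basis-spans {I} {S} (I⊆S , ind , ∣I∣≡rS) {e} e∈S with e ∈? I
  ... | yes e∈I = ∈⇒∈Span e∈I
  ... | no  e∉I with independent-or-dependent (I ∪ ⁅ e ⁆)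
  ...   | inj₂ (c , rel , nontrivial) = dependent-extension⇒∈Span ind rel nontrivial
  ...   | inj₁ ind' = ⊥-elim (ℕ.<⇒≢ ∣I∣<rS ∣I∣≡rS)
    where
    ∣I∣<rS : ∣ I ∣ < r S
    ∣I∣<rS = ℕ.<-≤-trans (p⊂q⇒∣p∣<∣q∣ (∉⇒⊂∪⁅⁆ e∉I)) (independent⇒∣∣≤r (∪⁅⁆⊆ I⊆S e∈S) ind')

  r≤r-if-spanned : ∀ {A B} → (∀ a → a ∈ A → v a ∈Span B) → r A ≤ r B
  r≤r-if-spanned {A} {B} A⊆SpanB =
    let I , I⊆A , indI , ∣I∣≡rA = basis A
        J , J-basis = basis B
        I⊆SpanJ t t∈I = span-trans (λ b → basis-spans J-basis) (A⊆SpanB t (I⊆A t∈I))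
    in subst₂ _≤_ ∣I∣≡rA (proj₂ (proj₂ J-basis)) (steinitz indI I⊆SpanJ)

  pair-independent : Simple r → ∀ {e f} → e ≢ f → Independent (⁅ e ⁆ ∪ ⁅ f ⁆)
  pair-independent (_ , r-pair≡2) {e} {f} e≢f with basis (⁅ e ⁆ ∪ ⁅ f ⁆)
  ... | T , T⊆ef , indT , ∣T∣≡r =
    independent-mono (∪⁅⁆⊆ (⁅⁆⊆ (∈T T⊆ef)) (∈T (subst (_ ∈_) (∪-comm ⁅ e ⁆ ⁅ f ⁆) ∘ T⊆ef))) indT
    where
    ∣T∣≡2 : ∣ T ∣ ≡ 2
    ∣T∣≡2 = trans ∣T∣≡r (r-pair≡2 e f e≢f)
    ∈T : ∀ {x y} → T ⊆ ⁅ x ⁆ ∪ ⁅ y ⁆ → x ∈ T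
    ∈T {x} {y} T⊆xy = decidable-stable (x ∈? T) λ x∉T →
      let T⊆y : T ⊆ ⁅ y ⁆
          T⊆y i∈T = [ (λ i∈x → ⊥-elim (x∉T (subst (_∈ T) (x∈⁅y⁆⇒x≡y x i∈x) i∈T))) , id ]′ (x∈p∪q⁻ _ _ (T⊆xy i∈T))
      in ℕ.<-irrefl refl (subst₂ _≤_ ∣T∣≡2 (∣⁅x⁆∣≡1 y) (p⊆q⇒∣p∣≤∣q∣ T⊆y))

  parallel⇒≡ : Simple r → ∀ {x y e f} → x ≢ 0# → (∀ j → x * v e j ≡ y * v f j) → e ≡ f
  parallel⇒≡ simple {x} {y} {e} {f} x≢0 parallel = decidable-stable (e Fin.≟ f) λ e≢f →
    x≢0 (trans (sym (ce≡x e≢f)) (pair-independent simple e≢f c c-supp Comb-c e))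
    where
    open ≡-Reasoning
    c : Fin n → Fin q
    c i = x * δ e i - y * δ f i
    c-supp : SupportedOn (⁅ e ⁆ ∪ ⁅ f ⁆) c
    c-supp i i∉ = begin
      x * δ e i - y * δ f i  ≡⟨ cong₂ (λ a b → x * a - y * b) (δ-supported (x∈p∪q⁺ (inj₁ (x∈⁅x⁆ e))) i i∉)
                                                              (δ-supported (x∈p∪q⁺ (inj₂ (x∈⁅x⁆ f))) i i∉) ⟩
      x * 0# - y * 0#        ≡⟨ cong₂ _-_ (zeroʳ x) (zeroʳ y) ⟩
      0# - 0#                ≡⟨ -‿inverseʳ 0# ⟩
      0#                     ∎
    ce≡x : e ≢ f → c e ≡ x
    ce≡x e≢f = begin
      x * δ e e - y * δ f e  ≡⟨ cong₂ (λ a b → x * a - y * b) (δ-same e) (δ-other e≢f) ⟩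
      x * 1# - y * 0#        ≡⟨ cong₂ (λ a b → a + - b) (*-identityʳ x) (zeroʳ y) ⟩
      x - 0#                 ≡⟨ cong (x +_) -0#≈0# ⟩
      x + 0#                 ≡⟨ +-identityʳ x ⟩
      x                      ∎
    Comb-c : ∀ j → Comb c j ≡ 0#
    Comb-c j = begin
      Comb c j                                                    ≡⟨ Comb-[c-c'] (λ i → x * δ e i) (λ i → y * δ f i) j ⟩
      Comb (λ i → x * δ e i) j - Comb (λ i → y * δ f i) j         ≡⟨ cong₂ _-_ (Comb-* x (δ e) j) (Comb-* y (δ f) j) ⟩
      x * Comb (δ e) j - y * Comb (δ f) j                         ≡⟨ cong₂ (λ a b → x * a - y * b) (Comb-δ e j) (Comb-δ f j) ⟩
      x * v e j - y * v f j                                       ≡⟨ cong (_- y * v f j) (parallel j) ⟩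
      y * v f j - y * v f j                                       ≡⟨ -‿inverseʳ (y * v f j) ⟩
      0#                                                          ∎

  module Coordinate {B : Subset n} (indB : Independent B) (spanB : ∀ e → v e ∈Span B)
                    {j₀ : Fin n} (j₀∈B : j₀ ∈ B) where

    coordinates : Fin n → Fin n → Fin q
    coordinates e = proj₁ (spanB e)

    coordinate : Fin n → Fin q
    coordinate e = coordinates e j₀

    coordinates-supported : ∀ e → SupportedOn B (coordinates e)
    coordinates-supported e = proj₁ (proj₂ (spanB e))

    coordinates-unique : ∀ {e c} → SupportedOn B c → (∀ j → Comb c j ≡ v e j) → ∀ i → c i ≡ coordinates e i
    coordinates-unique {e} c-supp Comb≡ =
      coefficients-unique indB c-supp (coordinates-supported e) λ j → trans (Comb≡ j) (sym (proj₂ (proj₂ (spanB e)) j))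

    coordinate-j₀ : coordinate j₀ ≡ 1#
    coordinate-j₀ = trans (sym (coordinates-unique (δ-supported j₀∈B) (Comb-δ j₀) j₀)) (δ-same j₀)

    coordinate-linear : ∀ {e c} → (∀ j → Comb c j ≡ v e j) → coordinate e ≡ sum (λ i → c i * coordinate i)
    coordinate-linear {e} {c} Comb≡ = sym (coordinates-unique (substitute-supported c coordinates-supported)
      (λ j → trans (Comb-substitute coordinates c (λ t j → cong (c t *_) (proj₂ (proj₂ (spanB t)) j)) j) (Comb≡ j)) j₀)

    coordinate≡0⇒∈Span : ∀ {e} → coordinate e ≡ 0# → v e ∈Span (B ─ ⁅ j₀ ⁆)
    coordinate≡0⇒∈Span {e} coordinate≡0 = coordinates e , supp , proj₂ (proj₂ (spanB e))
      where
      supp : SupportedOn (B ─ ⁅ j₀ ⁆) (coordinates e)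
      supp i i∉ = [ (λ { refl → coordinate≡0 })
                  , (λ i≢j₀ → coordinates-supported e i (i∉ ∘ λ i∈B → x∈p∧x≢y⇒x∈p-y i∈B i≢j₀)) ]′ (toSum (i Fin.≟ j₀))

    ∈Span⇒coordinate≡0 : ∀ {e} → v e ∈Span (B ─ ⁅ j₀ ⁆) → coordinate e ≡ 0#
    ∈Span⇒coordinate≡0 (c , c-supp , Comb≡) =
      trans (sym (coordinates-unique (λ i i∉B → c-supp i (i∉B ∘ p─q⊆p B ⁅ j₀ ⁆)) Comb≡ j₀)) (c-supp j₀ (x∉p-x j₀))

    r⊤≤∣B∣ : r ⊤ ≤ ∣ B ∣
    r⊤≤∣B∣ = ℕ.≤-trans (r≤r-if-spanned (λ e _ → spanB e)) (r≤∣∣ B)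

    -- the complement of the hyperplane spanned by B ─ ⁅ j₀ ⁆
    support-cocircuit : Cocircuit r (support coordinate)
    support-cocircuit = r∁C<r⊤ , minimal
      where
      r∁C<r⊤ : r (∁ (support coordinate)) < r ⊤
      r∁C<r⊤ = begin-strict
        r (∁ (support coordinate))  ≤⟨ r≤r-if-spanned (λ t t∈ → coordinate≡0⇒∈Span (∉-support (x∈∁p⇒x∉p t∈))) ⟩
        r (B ─ ⁅ j₀ ⁆)              ≤⟨ r≤∣∣ (B ─ ⁅ j₀ ⁆) ⟩
        ∣ B ─ ⁅ j₀ ⁆ ∣              <⟨ x∈p⇒∣p-x∣<∣p∣ j₀∈B ⟩
        ∣ B ∣                       ≤⟨ independent⇒∣∣≤r ⊆⊤ indB ⟩
        r ⊤                         ∎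
        where open ℕ.≤-Reasoning
      minimal : ∀ D → D ⊂ support coordinate → r (∁ D) ≡ r ⊤
      minimal D (D⊆C , e , e∈C , e∉D) = ℕ.≤-antisym (r-mono ⊆⊤) (begin
        r ⊤                            ≤⟨ r⊤≤∣B∣ ⟩
        ∣ B ∣                          ≡⟨ x∈p⇒∣p∣≡1+∣p-x∣ j₀∈B ⟩
        suc ∣ B ─ ⁅ j₀ ⁆ ∣             ≤⟨ p⊂q⇒∣p∣<∣q∣ (∉⇒⊂∪⁅⁆ e∉B-j₀) ⟩
        ∣ (B ─ ⁅ j₀ ⁆) ∪ ⁅ e ⁆ ∣       ≤⟨ independent⇒∣∣≤r (∪⁅⁆⊆ B-j₀⊆∁D (x∉p⇒x∈∁p e∉D)) exchanged ⟩
        r (∁ D)                        ∎)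
        where
        open ℕ.≤-Reasoning
        e∉SpanB-j₀ : ¬ (v e ∈Span (B ─ ⁅ j₀ ⁆))
        e∉SpanB-j₀ = ∈-support⁻ e∈C ∘ ∈Span⇒coordinate≡0
        e∉B-j₀ : e ∉ B ─ ⁅ j₀ ⁆
        e∉B-j₀ = e∉SpanB-j₀ ∘ ∈⇒∈Span
        B-j₀⊆∁D : B ─ ⁅ j₀ ⁆ ⊆ ∁ D
        B-j₀⊆∁D b∈ = x∉p⇒x∈∁p λ b∈D → ∈-support⁻ (D⊆C b∈D) (∈Span⇒coordinate≡0 (∈⇒∈Span b∈))
        exchanged : Independent ((B ─ ⁅ j₀ ⁆) ∪ ⁅ e ⁆)
        exchanged = independent-∪⁅⁆ (independent-mono (p─q⊆p B ⁅ j₀ ⁆) indB) e∉SpanB-j₀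

    support-small : Simple r → ∀ {X} → support coordinate ⊆ X → ∣ support coordinate ∣ ≤ q ^ (r X ∸ 1)
    support-small simple {X} C⊆X with basis X
    ... | K , K⊆X , indK , ∣K∣≡rX = subst (λ m → ∣ C ∣ ≤ q ^ m) ∣K-k₀∣≡rX∸1 (≤-^-if-injective code code-injective)
      where
      C : Subset n
      C = support coordinate
      open Rows {X} {K} (λ t → basis-spans (K⊆X , indK , ∣K∣≡rX))

      coordinate-via-K : ∀ {e} → e ∈ X → coordinate e ≡ sum (λ k → rows e k * coordinate k)
      coordinate-via-K e∈X = coordinate-linear (rows-spans e∈X)

      j₀∈C : j₀ ∈ C
      j₀∈C = ∈-support⁺ λ φj₀≡0 → 0≢1 (trans (sym φj₀≡0) coordinate-j₀)

      k₀-term : ∃ λ k → rows j₀ k * coordinate k ≢ 0#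
      k₀-term = sum≢0⇒∃≢0 _ λ sum≡0 → ∈-support⁻ j₀∈C (trans (coordinate-via-K (C⊆X j₀∈C)) sum≡0)
      k₀ : Fin n
      k₀ = proj₁ k₀-term
      k₀∈K : k₀ ∈ K
      k₀∈K = decidable-stable (k₀ ∈? K) λ k₀∉K →
        proj₂ k₀-term (trans (cong (_* coordinate k₀) (rows-supported j₀ k₀ k₀∉K)) (zeroˡ _))
      φk₀≢0 : coordinate k₀ ≢ 0#
      φk₀≢0 φk₀≡0 = proj₂ k₀-term (trans (cong (rows j₀ k₀ *_) φk₀≡0) (zeroʳ _))

      ∣K-k₀∣≡rX∸1 : ∣ K ─ ⁅ k₀ ⁆ ∣ ≡ r X ∸ 1
      ∣K-k₀∣≡rX∸1 = cong (_∸ 1) (trans (sym (x∈p⇒∣p∣≡1+∣p-x∣ k₀∈K)) ∣K∣≡rX)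

      β : Fin n → Fin n → Fin q
      β e k = coordinate e ⁻¹ * rows e k

      β-sum : ∀ {e} → e ∈ C → sum (λ k → β e k * coordinate k) ≡ 1#
      β-sum {e} e∈C = begin
        sum (λ k → β e k * coordinate k)                       ≡⟨ sum-cong-≗ (λ k → *-assoc _ (rows e k) _) ⟩
        sum (λ k → coordinate e ⁻¹ * (rows e k * coordinate k)) ≡⟨ *-distribˡ-sum _ (λ k → rows e k * coordinate k) ⟨
        coordinate e ⁻¹ * sum (λ k → rows e k * coordinate k)   ≡⟨ cong (coordinate e ⁻¹ *_) (coordinate-via-K (C⊆X e∈C)) ⟨
        coordinate e ⁻¹ * coordinate e                         ≡⟨ *-comm _ (coordinate e) ⟩
        coordinate e * coordinate e ⁻¹                         ≡⟨ x*x⁻¹≡1 (∈-support⁻ e∈C) ⟩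
        1#                                                     ∎
        where open ≡-Reasoning

      β-injective : ∀ {e f} → e ∈ C → f ∈ C → (∀ k → k ∈ K ─ ⁅ k₀ ⁆ → β e k ≡ β f k) → e ≡ f
      β-injective {e} {f} e∈C f∈C agree = parallel⇒≡ simple (x⁻¹≢0 (∈-support⁻ e∈C)) λ j → begin
        coordinate e ⁻¹ * v e j           ≡⟨ cong (coordinate e ⁻¹ *_) (rows-spans (C⊆X e∈C) j) ⟨
        coordinate e ⁻¹ * Comb (rows e) j ≡⟨ Comb-* _ (rows e) j ⟨
        Comb (β e) j                      ≡⟨ Comb-cong β≗ j ⟩
        Comb (β f) j                      ≡⟨ Comb-* _ (rows f) j ⟩
        coordinate f ⁻¹ * Comb (rows f) j ≡⟨ cong (coordinate f ⁻¹ *_) (rows-spans (C⊆X f∈C) j) ⟩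
        coordinate f ⁻¹ * v f j           ∎
        where
        open ≡-Reasoning
        off-k₀ : ∀ k → k ≢ k₀ → β e k ≡ β f k
        off-k₀ k k≢k₀ = [ (λ k∈K → agree k (x∈p∧x≢y⇒x∈p-y k∈K k≢k₀))
                        , (λ k∉K → trans (cong (_ *_) (rows-supported e k k∉K))
                                   (trans (zeroʳ _) (sym (trans (cong (_ *_) (rows-supported f k k∉K)) (zeroʳ _))))) ]′
                        (toSum (k ∈? K))
        difference : Fin n → Fin q
        difference k = β e k * coordinate k - β f k * coordinate k
        difference≡0 : difference k₀ ≡ 0#
        difference≡0 = begin
          difference k₀          ≡⟨ sum-single difference k₀ vanishes-off-k₀ ⟨
          sum difference         ≡⟨ sum-[f-g] (λ k → β e k * coordinate k) (λ k → β f k * coordinate k) ⟩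
          sum (λ k → β e k * coordinate k) - sum (λ k → β f k * coordinate k)
                                 ≡⟨ cong₂ _-_ (β-sum e∈C) (β-sum f∈C) ⟩
          1# - 1#                ≡⟨ -‿inverseʳ 1# ⟩
          0#                     ∎
          where
          vanishes-off-k₀ : ∀ k → k ≢ k₀ → difference k ≡ 0#
          vanishes-off-k₀ k k≢k₀ = trans (cong (λ x → x * coordinate k - β f k * coordinate k) (off-k₀ k k≢k₀))
                                         (-‿inverseʳ (β f k * coordinate k))
        at-k₀ : β e k₀ ≡ β f k₀
        at-k₀ = *-cancelʳ φk₀≢0 (x∙y⁻¹≈ε⇒x≈y (β e k₀ * coordinate k₀) (β f k₀ * coordinate k₀) difference≡0)
        β≗ : ∀ k → β e k ≡ β f k
        β≗ k = [ (λ { refl → at-k₀ }) , off-k₀ k ]′ (toSum (k Fin.≟ k₀))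

      code : Fin ∣ C ∣ → Fin ∣ K ─ ⁅ k₀ ⁆ ∣ → Fin q
      code i = β (enumerate C i) ∘ enumerate (K ─ ⁅ k₀ ⁆)

      code-injective : ∀ {i i'} → code i ≗ code i' → i ≡ i'
      code-injective {i} {i'} code≗ = enumerate-injective C (β-injective (enumerate-∈ C i) (enumerate-∈ C i')
        λ k k∈ → let l , eq = enumerate-surjective (K ─ ⁅ k₀ ⁆) k∈ in subst (λ k → β _ k ≡ β _ k) eq (code≗ l))

  codependent⇒hyperplane-basis : ∀ {X} → Codependent r X →
    Σ (Subset n) λ B → Independent B × (∀ e → v e ∈Span B) ×
    Σ (Fin n) λ j₀ → j₀ ∈ B × (∀ {e} → e ∉ X → v e ∈Span (B ─ ⁅ j₀ ⁆))
  codependent⇒hyperplane-basis {X} r∁X<r⊤ with basis (∁ X)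
  ... | I , I⊆∁X , indI , ∣I∣≡r with extend-to-spanning indI (allFin n)
  ...   | B , indB , I⊆B , spans = B , indB , spanB , j₀ , j₀∈B , ∁X⊆Span
    where
    spanB : ∀ e → v e ∈Span B
    spanB e = spans e (∈-allFin e)
    B⊈I : ¬ (∀ j → j ∈ B → j ∈ I)
    B⊈I B⊆I = ℕ.<⇒≱ r∁X<r⊤ (ℕ.≤-trans (r≤r-if-spanned λ e _ → span-mono (B⊆I _) (spanB e)) (r-mono I⊆∁X))
    j₀-witness : ∃ λ j → ¬ (j ∈ B → j ∈ I)
    j₀-witness = ¬∀⟶∃¬ n _ (λ j → (j ∈? B) →-dec (j ∈? I)) B⊈I
    j₀ : Fin n
    j₀ = proj₁ j₀-witness
    j₀∈B : j₀ ∈ B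
    j₀∈B = decidable-stable (j₀ ∈? B) λ j₀∉B → proj₂ j₀-witness (⊥-elim ∘ j₀∉B)
    j₀∉I : j₀ ∉ I
    j₀∉I j₀∈I = proj₂ j₀-witness λ _ → j₀∈I
    ∁X⊆Span : ∀ {e} → e ∉ X → v e ∈Span (B ─ ⁅ j₀ ⁆)
    ∁X⊆Span e∉X = span-mono (λ i∈I → x∈p∧x≢y⇒x∈p-y (I⊆B i∈I) λ { refl → j₀∉I i∈I })
                             (basis-spans (I⊆∁X , indI , ∣I∣≡r) (x∉p⇒x∈∁p e∉X))

  codependent⇒small-cocircuit : Simple r → ∀ {X} → Codependent r X →
    Σ (Subset n) λ C → Cocircuit r C × ∣ C ∣ ≤ q ^ (r X ∸ 1)
  codependent⇒small-cocircuit simple {X} r∁X<r⊤ =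
    let B , indB , spanB , j₀ , j₀∈B , ∁X⊆Span = codependent⇒hyperplane-basis r∁X<r⊤
        open Coordinate indB spanB j₀∈B
    in support coordinate , support-cocircuit , support-small simple λ {e} e∈C →
         decidable-stable (e ∈? X) λ e∉X → ∈-support⁻ e∈C (∈Span⇒coordinate≡0 (∁X⊆Span e∉X))

open import Data.Integer as ℤ using (ℤ; +_)
import Data.Integer.Properties as ℤ

module _ {m : ℕ} (T : Tree m) where

  sumℤ-zero : ∀ {k} (f : Fin k → ℤ) → (∀ i → f i ≡ + 0) → sumℤ T f ≡ + 0
  sumℤ-zero {zero}  f f≡0 = refl
  sumℤ-zero {suc k} f f≡0 = cong₂ ℤ._+_ (f≡0 zero) (sumℤ-zero (f ∘ suc) (f≡0 ∘ suc))

  maxℤ-upper : ∀ {k} (f : Fin (suc k) → ℤ) i → f i ℤ.≤ maxℤ T f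
  maxℤ-upper {zero}  f zero    = ℤ.≤-refl
  maxℤ-upper {suc k} f zero    = ℤ.i≤i⊔j (f zero) _
  maxℤ-upper {suc k} f (suc i) = ℤ.≤-trans (maxℤ-upper (f ∘ suc) i) (ℤ.i≤j⊔i (f zero) _)

module TreeDecomposition {n : ℕ} (r : RankFn n) (r-mono : ∀ {S S'} → S ⊆ S' → r S ≤ r S')
                         (r≤∣∣ : ∀ S → r S ≤ ∣ S ∣) where

  single-vertex : Tree 0
  single-vertex = record { parent = λ () ; parent< = λ () }

  module _ {m : ℕ} (T : Tree m) (τ : Fin n → Fin (suc m)) where
    open Tree T

    Candidate : Fin (suc m) → Set
    Candidate w = w ≡ zero ⊎ Codependent r (Bsub T r τ w)

    NoCodependentChild : Fin (suc m) → Set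
    NoCodependentChild w = ∀ i → parent i ≡ w → ¬ Codependent r (Bsub T r τ (suc i))

    -- Walk down from the root into codependent subtrees; the fuel suffices because
    -- vertex indices increase along the way.
    descend : ∀ fuel w → suc m ≤ toℕ w ℕ.+ fuel → Candidate w →
              Σ (Fin (suc m)) λ w' → Candidate w' × NoCodependentChild w'
    descend zero w bound _ =
      ⊥-elim (ℕ.<-irrefl refl (ℕ.<-≤-trans (toℕ<n w) (ℕ.≤-trans bound (ℕ.≤-reflexive (ℕ.+-identityʳ _)))))
    descend (suc fuel) w bound cand
      with any? (λ i → (parent i Fin.≟ w) ×-dec (r (∁ (Bsub T r τ (suc i))) ℕ.<? r ⊤))
    ... | yes (i , parent≡w , codep) = descend fuel (suc i) bound' (inj₂ codep)
      where
      bound' : suc m ≤ suc (toℕ i) ℕ.+ fuel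
      bound' = ℕ.≤-trans bound (ℕ.≤-trans (ℕ.≤-reflexive (ℕ.+-suc (toℕ w) fuel))
                 (s≤s (ℕ.+-monoˡ-≤ fuel (subst (λ u → toℕ u ≤ toℕ i) parent≡w (parent< i)))))
    ... | no none = w , cand , λ i parent≡w codep → none (i , parent≡w , codep)

    children-rd≡0 : ∀ {w} → NoCodependentChild w →
      sumℤ T (λ i → if ⌊ parent i Fin.≟ w ⌋ then rd T r τ (Bsub T r τ (suc i)) else + 0) ≡ + 0
    children-rd≡0 {w} none = sumℤ-zero T _ term
      where
      term : ∀ i → (if ⌊ parent i Fin.≟ w ⌋ then rd T r τ (Bsub T r τ (suc i)) else + 0) ≡ + 0
      term i with parent i Fin.≟ w
      ... | yes parent≡w = trans (cong (λ x → + r ⊤ ℤ.- + x) (ℕ.≤-antisym (r-mono ⊆⊤) (ℕ.≮⇒≥ (none i parent≡w))))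
                                 (ℤ.+-inverseʳ (+ r ⊤))
      ... | no  _        = refl

    ∁Bup≡Bsub : ∀ w → ∁ (Bup T r τ w) ≡ Bsub T r τ w
    ∁Bup≡Bsub w = trans (sym (tabulate-∘ not _)) (tabulate-cong λ e → not-if (inSub T w (τ e)))
      where
      not-if : ∀ b → not (if b then false else true) ≡ b
      not-if true  = refl
      not-if false = refl

    codependent-of-rank≤width : 0 < r ⊤ → Σ (Subset n) λ X → Codependent r X × + r X ℤ.≤ width T r τ
    codependent-of-rank≤width 0<r⊤ with descend (suc m) zero ℕ.≤-refl (inj₁ refl)
    ... | zero , _ , none = ⊤ , r∅<r⊤ , subst (ℤ._≤ width T r τ) root-width (maxℤ-upper T (nodeWidth T r τ) zero)
      where
      r∅<r⊤ : r (∁ ⊤) < r ⊤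
      r∅<r⊤ = ℕ.≤-<-trans (subst (r (∁ ⊤) ≤_) ∣∁⊤∣≡0 (r≤∣∣ (∁ ⊤))) 0<r⊤
        where
        ∣∁⊤∣≡0 : ∣ ∁ (⊤ {n}) ∣ ≡ 0
        ∣∁⊤∣≡0 = trans (∣∁p∣≡n∸∣p∣ (⊤ {n})) (trans (cong (n ∸_) (∣⊤∣≡n n)) (ℕ.n∸n≡0 n))
      root-width : nodeWidth T r τ zero ≡ + r ⊤
      root-width = trans (cong (λ x → + r ⊤ ℤ.- (x ℤ.+ + 0)) (children-rd≡0 none)) (cong +_ (ℕ.+-identityʳ (r ⊤)))
    ... | suc j , inj₂ codep , none =
      Bsub T r τ (suc j) , codep , subst (ℤ._≤ width T r τ) node-width (maxℤ-upper T (nodeWidth T r τ) (suc j))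
      where
      a-[0+[a-b]]≡b : ∀ a b → a ℤ.- (+ 0 ℤ.+ (a ℤ.- b)) ≡ b
      a-[0+[a-b]]≡b = solve-∀
      node-width : nodeWidth T r τ (suc j) ≡ + r (Bsub T r τ (suc j))
      node-width = begin
        nodeWidth T r τ (suc j)
          ≡⟨ cong (λ x → + r ⊤ ℤ.- (x ℤ.+ rd T r τ (Bup T r τ (suc j)))) (children-rd≡0 none) ⟩
        + r ⊤ ℤ.- (+ 0 ℤ.+ (+ r ⊤ ℤ.- + r (∁ (Bup T r τ (suc j))))) ≡⟨ a-[0+[a-b]]≡b (+ r ⊤) _ ⟩
        + r (∁ (Bup T r τ (suc j)))                                 ≡⟨ cong (+_ ∘ r) (∁Bup≡Bsub (suc j)) ⟩
        + r (Bsub T r τ (suc j))                                    ∎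
        where open ≡-Reasoning

lemma3p5 : (q : ℕ) → IsPrimePower q → (F : FiniteField q) →
    (k : ℕ) → 0 < k →
    (n : ℕ) → (r : RankFn n) → Representable F r → Simple r →
    TreeWidth r k →
    Σ (Subset n) λ C → Cocircuit r C × ∣ C ∣ ≤ q ^ (k ∸ 1)
lemma3p5 q _ F k 0<k n r (d , v , rep) simple ((m , T , τ , width≡k) , width≥k) =
  let X , codependent , rX≤width = codependent-of-rank≤width T τ (ℕ.<-≤-trans 0<k k≤r⊤)
      C , cocircuit , ∣C∣≤q^[rX∸1] = codependent⇒small-cocircuit simple codependent
      rX≤k = ℤ.drop‿+≤+ (subst (+ r X ℤ.≤_) width≡k rX≤width)
  in C , cocircuit , ℕ.≤-trans ∣C∣≤q^[rX∸1] (ℕ.^-monoʳ-≤ q ⦃ nonZeroIndex (FiniteField.0# F) ⦄ (ℕ.∸-monoˡ-≤ 1 rX≤k))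
  where
  open RepresentedMatroid F v r rep
  open TreeDecomposition r r-mono r≤∣∣

  k≤r⊤ : k ≤ r ⊤
  k≤r⊤ = subst (k ≤_) (ℕ.+-identityʳ (r ⊤)) (ℤ.drop‿+≤+ (width≥k 0 single-vertex (λ _ → zero)))
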